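{- Let $m,n$ be positive integers and consider a coloring of the edges of the complete bipartite graph $K_{m,n}$ with $3$ colors which is a bi-equivalence coloring, i.e. every monochromatic component is a complete bipartite graph. Then there exists a monochromatic complete bipartite subgraph $K_{\lceil m/3\rceil,\lceil n/3\rceil}$ whose $\lceil m/3\rceil$-side lies in the class of size $m$ and whose $\lceil n/3\rceil$-side lies in the class of size $n$.
   Context: A monochromatic component of color $i$ is a connected component of the subgraph formed by the edges of color $i$. -}

module Defs where

open import Data.Nat using (ℕ; _+_)
open import Data.Nat.DivMod using (_/_)
open import Data.Fin using (Fin)
open import Data.Sum using (_⊎_; inj₁; inj₂)
open import Relation.Binary.PropositionalEquality using (_≡_)
open import Relation.Binary.Construct.Closure.ReflexiveTransitive using (Star)

-- A k-edge-coloring of the complete bipartite graph K_{m,n}: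
-- left class Fin m, right class Fin n, every pair (a , b) is an edge.
Coloring : ℕ → ℕ → ℕ → Set
Coloring m n k = Fin m → Fin n → Fin k

Vertex : ℕ → ℕ → Set
Vertex m n = Fin m ⊎ Fin n

data Adj {m n k : ℕ} (c : Coloring m n k) (i : Fin k) : Vertex m n → Vertex m n → Set where
  lr : ∀ a b → c a b ≡ i → Adj c i (inj₁ a) (inj₂ b)
  rl : ∀ a b → c a b ≡ i → Adj c i (inj₂ b) (inj₁ a)

Connected : {m n k : ℕ} → Coloring m n k → Fin k → Vertex m n → Vertex m n → Set
Connected c i = Star (Adj c i)

-- Bi-equivalence coloring: every monochromatic component is a complete
-- bipartite graph, i.e. whenever a left vertex a and a right vertex b lie in
-- the same component of color i, the edge ab has color i.
BiEquivalence : {m n k : ℕ} → Coloring m n k → Set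
BiEquivalence {m} {n} {k} c =
  (i : Fin k) (a : Fin m) (b : Fin n) → Connected c i (inj₁ a) (inj₂ b) → c a b ≡ i

⌈_/3⌉ : ℕ → ℕ
⌈ m /3⌉ = (m + 2) / 3

module Submission where

-- In a bi-equivalence colouring of K_{m,n}, a colour-x path
-- a – b – a' – b' forces the edge ab' to have colour x ("rectangle rule").
-- Pick a row a₀; some colour i occupies a set B of at least ⌈n/3⌉ columns
-- of it, and we fix b₀ ∈ B.  In column b₀ some colour j occupies a set A of
-- at least ⌈m/3⌉ rows.  If j = i, the rectangle rule makes A × B of colour
-- i.  Otherwise either A × B has colour j, or some a₂ ∈ A, b₂ ∈ B has
-- c a₂ b₂ ≠ j; then every row of A agrees with row a₂ at b₀ (colour j) and
-- at b₂ (the third colour), and with only three colours two rows that agree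
-- at columns of two different colours are identical.  So all rows of A
-- equal row a₂, and A × T is monochromatic for the largest colour class T
-- of row a₂.  Shrinking the block to exact sizes gives the corollary.

open import Defs
open import Data.Nat using (ℕ; NonZero)
open import Data.Fin using (Fin)
open import Data.Fin.Subset using (Subset; _∈_; ∣_∣)
open import Data.Product using (_×_; ∃-syntax)
open import Relation.Binary.PropositionalEquality using (_≡_)
open import Data.Nat using (zero; suc; _+_; _*_; _⊔_; _≤_; _<_; s≤s; s≤s⁻¹)
open import Data.Nat.Properties
  using (≤-trans; ≤-reflexive; +-mono-≤; m≤m⊔n; m≤n⊔m; ⊔-sel; +-suc; +-comm; *-comm; m≤n+m; n<1+n)
open import Data.Nat.Tactic.RingSolver using (solve-∀)
open import Data.Nat.DivMod using (m<n*o⇒m/o<n; m≥n⇒m/n>0)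
open import Data.Fin using (zero; suc; _≟_)
open import Data.Fin.Properties using (any?; pigeonhole)
open import Data.Fin.Subset using (_⊆_; inside; outside; Nonempty) renaming (⊥ to ∅)
open import Data.Fin.Subset.Properties using (⊆-min; s⊆s; ∣⊥∣≡0; _∈?_; nonempty?; Empty-unique)
open import Data.Vec using (_∷_; []; tabulate; lookup)
open import Data.Vec.Properties using (lookup∘tabulate; []=⇒lookup)
open import Data.Product using (_,_; ∃₂)
open import Data.Sum using (_⊎_; inj₁; inj₂)
import Data.Sum as Sum
open import Relation.Nullary using (yes; no; does; contradiction)
open import Relation.Nullary.Decidable using (_×-dec_; ¬?; decidable-stable)
open import Relation.Binary.PropositionalEquality using (refl; sym; trans; cong; _≢_; subst)
open import Relation.Binary.Construct.Closure.ReflexiveTransitive using (ε; _◅_)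

private
  variable
    k m n : ℕ

shrink : ∀ {k} (p : Subset n) → k ≤ ∣ p ∣ → ∃[ q ] (q ⊆ p × ∣ q ∣ ≡ k)
shrink {n} {k = zero} p _ = ∅ , ⊆-min p , ∣⊥∣≡0 n
shrink {k = suc k} (outside ∷ p) h with shrink p h
... | q , q⊆p , ∣q∣≡k = outside ∷ q , s⊆s q⊆p , ∣q∣≡k
shrink {k = suc k} (inside ∷ p) h with shrink p (s≤s⁻¹ h)
... | q , q⊆p , ∣q∣≡k = inside ∷ q , s⊆s q⊆p , cong suc ∣q∣≡k

element : (p : Subset n) → 1 ≤ ∣ p ∣ → Nonempty p
element {n} p h with nonempty? p
... | yes ne = ne
... | no empty = contradiction 1≤0 λ ()
  where
  1≤0 : 1 ≤ 0
  1≤0 = ≤-trans h (≤-reflexive (trans (cong ∣_∣ (Empty-unique empty)) (∣⊥∣≡0 n)))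

fiber : (Fin n → Fin k) → Fin k → Subset n
fiber f x = tabulate (λ b → does (f b ≟ x))

∈fiber⁻ : ∀ (f : Fin n → Fin k) {x b} → b ∈ fiber f x → f b ≡ x
∈fiber⁻ f {x} {b} b∈ with f b ≟ x | trans (sym (lookup∘tabulate _ b)) ([]=⇒lookup b∈)
... | yes fb≡x | _ = fb≡x
... | no _ | ()

fiber-sizes : (f : Fin n → Fin 3) →
  ∣ fiber f zero ∣ + ∣ fiber f (suc zero) ∣ + ∣ fiber f (suc (suc zero)) ∣ ≡ n
fiber-sizes {zero} f = refl
fiber-sizes {suc n} f with f zero | fiber-sizes (λ b → f (suc b))
... | zero | ih = cong suc ih
... | suc zero | ih = trans (cong (_+ size₂) (+-suc size₀ size₁)) (cong suc ih)
  where
  size₀ size₁ size₂ : ℕ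
  size₀ = ∣ fiber (λ b → f (suc b)) zero ∣
  size₁ = ∣ fiber (λ b → f (suc b)) (suc zero) ∣
  size₂ = ∣ fiber (λ b → f (suc b)) (suc (suc zero)) ∣
... | suc (suc zero) | ih = trans (+-suc _ _) (cong suc ih)

sum≤3*max : ∀ a b c → a + b + c ≤ 3 * (a ⊔ b ⊔ c)
sum≤3*max a b c = ≤-trans (+-mono-≤ (+-mono-≤ a≤M b≤M) c≤M) (≤-reflexive (triple (a ⊔ b ⊔ c)))
  where
  a≤M : a ≤ a ⊔ b ⊔ c
  a≤M = ≤-trans (m≤m⊔n a b) (m≤m⊔n (a ⊔ b) c)
  b≤M : b ≤ a ⊔ b ⊔ c
  b≤M = ≤-trans (m≤n⊔m a b) (m≤m⊔n (a ⊔ b) c)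
  c≤M : c ≤ a ⊔ b ⊔ c
  c≤M = m≤n⊔m (a ⊔ b) c
  triple : ∀ M → M + M + M ≡ 3 * M
  triple = solve-∀

third-of-sum : ∀ a b c →
  a + b + c ≤ 3 * a ⊎ a + b + c ≤ 3 * b ⊎ a + b + c ≤ 3 * c
third-of-sum a b c with ⊔-sel (a ⊔ b) c | ⊔-sel a b
... | inj₂ M≡c | _ = inj₂ (inj₂ (subst (λ M → a + b + c ≤ 3 * M) M≡c (sum≤3*max a b c)))
... | inj₁ M≡ab | inj₁ ab≡a = inj₁ (subst (λ M → a + b + c ≤ 3 * M) (trans M≡ab ab≡a) (sum≤3*max a b c))
... | inj₁ M≡ab | inj₂ ab≡b = inj₂ (inj₁ (subst (λ M → a + b + c ≤ 3 * M) (trans M≡ab ab≡b) (sum≤3*max a b c)))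

⌈/3⌉-least : ∀ {n M} → n ≤ 3 * M → ⌈ n /3⌉ ≤ M
⌈/3⌉-least {n} {M} n≤3M = s≤s⁻¹ (m<n*o⇒m/o<n n+2<[1+M]*3)
  where
  n+2<[1+M]*3 : n + 2 < suc M * 3
  n+2<[1+M]*3 = subst (_< suc M * 3) (+-comm 2 n)
    (s≤s (s≤s (s≤s (≤-trans n≤3M (≤-reflexive (*-comm 3 M))))))

⌈/3⌉-pos : ∀ n → 1 ≤ ⌈ suc n /3⌉
⌈/3⌉-pos n = m≥n⇒m/n>0 (s≤s (m≤n+m 2 n))

third-of-partition : ∀ a b c → a + b + c ≡ n →
  ⌈ n /3⌉ ≤ a ⊎ ⌈ n /3⌉ ≤ b ⊎ ⌈ n /3⌉ ≤ c
third-of-partition a b c refl =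
  Sum.map ⌈/3⌉-least (Sum.map ⌈/3⌉-least ⌈/3⌉-least) (third-of-sum a b c)

popular : (f : Fin n → Fin 3) → ∃[ x ] ⌈ n /3⌉ ≤ ∣ fiber f x ∣
popular f with third-of-partition _ _ _ (fiber-sizes f)
... | inj₁ h = zero , h
... | inj₂ (inj₁ h) = suc zero , h
... | inj₂ (inj₂ h) = suc (suc zero) , h

third-unique : ∀ {x y u v : Fin 3} → x ≢ y →
  u ≢ x → u ≢ y → v ≢ x → v ≢ y → u ≡ v
third-unique {x} {y} {u} {v} x≢y u≢x u≢y v≢x v≢y with u ≟ v
... | yes u≡v = u≡v
... | no u≢v with pigeonhole (n<1+n 3) (lookup (x ∷ y ∷ u ∷ v ∷ []))
... | zero , suc zero , _ , e = contradiction e x≢y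
... | zero , suc (suc zero) , _ , e = contradiction (sym e) u≢x
... | zero , suc (suc (suc zero)) , _ , e = contradiction (sym e) v≢x
... | suc zero , suc (suc zero) , _ , e = contradiction (sym e) u≢y
... | suc zero , suc (suc (suc zero)) , _ , e = contradiction (sym e) v≢y
... | suc (suc zero) , suc (suc (suc zero)) , _ , e = contradiction e u≢v
... | suc zero , suc zero , s≤s () , _
... | suc (suc _) , suc zero , s≤s () , _
... | suc (suc _) , suc (suc zero) , s≤s (s≤s ()) , _
... | suc (suc (suc _)) , suc (suc (suc zero)) , s≤s (s≤s (s≤s ())) , _

column : Coloring m n k → Fin n → Fin m → Fin k
column c b a = c a b

Block : Coloring m n k → Fin k → Subset m → Subset n → Set
Block {m} {n} c x A B = (a : Fin m) (b : Fin n) → a ∈ A → b ∈ B → c a b ≡ x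

block-or-witness : (c : Coloring m n k) (x : Fin k) (A : Subset m) (B : Subset n) →
  Block c x A B ⊎ ∃₂ λ a b → a ∈ A × b ∈ B × c a b ≢ x
block-or-witness c x A B
  with any? (λ a → any? (λ b → a ∈? A ×-dec b ∈? B ×-dec ¬? (c a b ≟ x)))
... | yes (a , b , a∈A , b∈B , ab≢x) = inj₂ (a , b , a∈A , b∈B , ab≢x)
... | no none = inj₁ λ a b a∈A b∈B →
  decidable-stable (c a b ≟ x) λ ab≢x → none (a , b , a∈A , b∈B , ab≢x)

module _ {m n k : ℕ} {c : Coloring m n k} (bi : BiEquivalence c) where

  -- Rectangle rule: the colour-x path a – b – a' – b' puts a and b' in one
  -- colour-x component, so the edge ab' has colour x.
  rectangle : ∀ {x a a' b b'} → c a b ≡ x → c a' b ≡ x → c a' b' ≡ x → c a b' ≡ x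
  rectangle {x} {a} {a'} {b} {b'} ab≡x a'b≡x a'b'≡x =
    bi x a b' (lr a b ab≡x ◅ rl a' b a'b≡x ◅ lr a' b' a'b'≡x ◅ ε)

module _ {m n : ℕ} {c : Coloring m n 3} (bi : BiEquivalence c) where

  -- With three colours, two rows that agree at a column of colour x and at a
  -- column of another colour y are identical: at any column they share the
  -- colour x, or y, or else both carry the remaining third colour.
  rows-equal : ∀ {x y a a' b b'} → x ≢ y →
    c a b ≡ x → c a' b ≡ x → c a b' ≡ y → c a' b' ≡ y → ∀ d → c a d ≡ c a' d
  rows-equal {x} {y} {a} {a'} x≢y ab≡x a'b≡x ab'≡y a'b'≡y d with c a' d ≟ x | c a' d ≟ y
  ... | yes a'd≡x | _ = trans (rectangle bi ab≡x a'b≡x a'd≡x) (sym a'd≡x)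
  ... | no _ | yes a'd≡y = trans (rectangle bi ab'≡y a'b'≡y a'd≡y) (sym a'd≡y)
  ... | no a'd≢x | no a'd≢y = third-unique x≢y
    (λ ad≡x → a'd≢x (rectangle bi a'b≡x ab≡x ad≡x))
    (λ ad≡y → a'd≢y (rectangle bi a'b'≡y ab'≡y ad≡y))
    a'd≢x a'd≢y

  -- Then c a' b₂ is the
  -- third colour, so is c a b₂, and rows a and a' coincide.
  rows-agree : ∀ {i j a₀ a a' b₀ b₂} → j ≢ i → c a₀ b₀ ≡ i → c a₀ b₂ ≡ i →
    c a b₀ ≡ j → c a' b₀ ≡ j → c a' b₂ ≢ j → ∀ d → c a d ≡ c a' d
  rows-agree {i} {j} {a = a} {a'} {b₀} {b₂} j≢i a₀b₀≡i a₀b₂≡i ab₀≡j a'b₀≡j a'b₂≢j =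
    rows-equal j≢third ab₀≡j a'b₀≡j ab₂≡third refl
    where
    avoids-i : ∀ {r} → c r b₀ ≡ j → c r b₂ ≢ i
    avoids-i rb₀≡j rb₂≡i = j≢i (trans (sym rb₀≡j) (rectangle bi rb₂≡i a₀b₂≡i a₀b₀≡i))
    ab₂≢j : c a b₂ ≢ j
    ab₂≢j ab₂≡j = a'b₂≢j (rectangle bi a'b₀≡j ab₀≡j ab₂≡j)
    ab₂≡third : c a b₂ ≡ c a' b₂
    ab₂≡third = third-unique j≢i ab₂≢j (avoids-i ab₀≡j) a'b₂≢j (avoids-i a'b₀≡j)
    j≢third : j ≢ c a' b₂
    j≢third j≡ = a'b₂≢j (sym j≡)

  cross : ∀ {i} j {a₀ b₀} → c a₀ b₀ ≡ i →
    (∃[ x ] Block c x (fiber (column c b₀) j) (fiber (c a₀) i)) ⊎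
    (∃[ a₂ ] ∀ a → a ∈ fiber (column c b₀) j → ∀ d → c a d ≡ c a₂ d)
  cross {i} j {a₀} {b₀} a₀b₀≡i with j ≟ i
  ... | yes refl = inj₁ (i , λ a b a∈A b∈B →
    rectangle bi (∈fiber⁻ (column c b₀) a∈A) a₀b₀≡i (∈fiber⁻ (c a₀) b∈B))
  ... | no j≢i with block-or-witness c j (fiber (column c b₀) j) (fiber (c a₀) i)
  ...   | inj₁ block = inj₁ (j , block)
  ...   | inj₂ (a₂ , b₂ , a₂∈A , b₂∈B , a₂b₂≢j) = inj₂ (a₂ , λ a a∈A →
    rows-agree j≢i a₀b₀≡i (∈fiber⁻ (c a₀) b₂∈B)
      (∈fiber⁻ (column c b₀) a∈A) (∈fiber⁻ (column c b₀) a₂∈A) a₂b₂≢j)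

LargeBlock : Coloring m n k → Set
LargeBlock {m} {n} c =
  ∃[ x ] ∃[ A ] ∃[ B ] (⌈ m /3⌉ ≤ ∣ A ∣ × ⌈ n /3⌉ ≤ ∣ B ∣ × Block c x A B)

large-block : (c : Coloring (suc m) (suc n) 3) → BiEquivalence c → LargeBlock c
large-block {n = n} c bi with popular (c zero)
... | i , |B| with element (fiber (c zero) i) (≤-trans (⌈/3⌉-pos n) |B|)
... | b₀ , b₀∈B with popular (column c b₀)
... | j , |A| with cross bi j (∈fiber⁻ (c zero) b₀∈B)
... | inj₁ (x , block) = x , _ , _ , |A| , |B| , block
... | inj₂ (a₂ , equal-rows) with popular (c a₂)
... | x , |T| = x , _ , _ , |A| , |T| , λ a b a∈A b∈T →
  trans (equal-rows a a∈A b) (∈fiber⁻ (c a₂) b∈T)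

corollary1 : (m n : ℕ) → .{{NonZero m}} → .{{NonZero n}} →
    (c : Coloring m n 3) → BiEquivalence c →
    ∃[ i ] ∃[ S ] ∃[ T ] (∣ S ∣ ≡ ⌈ m /3⌉ × ∣ T ∣ ≡ ⌈ n /3⌉ ×
    ((a : Fin m) (b : Fin n) → a ∈ S → b ∈ T → c a b ≡ i))
corollary1 (suc m) (suc n) c bi with large-block c bi
... | x , A , B , |A| , |B| , block with shrink A |A| | shrink B |B|
... | S , S⊆A , |S| | T , T⊆B , |T| =
  x , S , T , |S| , |T| , λ a b a∈S b∈T → block a b (S⊆A a∈S) (T⊆B b∈T)
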